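{- For any simple temporal graph $\mathcal{G}=(V,E,\lambda)$ with lifetime $T_{\max}$ and any parameters $\delta,k\in\mathbb{N}^+$, there is a Discoverer strategy that wins the temporal graph discovery game on $\mathcal{G}$ in $|V|\cdot T_{\max}$ rounds.
   Context: A simple temporal graph $\mathcal{G}=(V,E,\lambda)$ with lifetime $T_{\max}$ consists of a finite undirected static graph $(V,E)$ and a labeling $\lambda:E\to\{1,\dots,T_{\max}\}$; edge $e$ is present only at time $\lambda(e)$. Infection model with parameter $\delta$: all nodes start susceptible; a seed infection $(v,t)\in V\times[0,T_{\max}]$ makes $v$ infected at time $t$ (if susceptible); otherwise a susceptible node $u$ becomes infected at time $t$ iff some node $v$ infectious at time $t$ has an edge $uv$ with $\lambda(uv)=t$ (if several, $u$ is infected by exactly one of them, any one). A node infected at time $t$ is infectious at times $t+1,\dots,t+\delta$ and resistant afterwards. The infection log of such an infection chain is the set of triples $(u,v,t)$ meaning $u$ infected $v$ at time $t$ (seed infections recorded as $(u,u,t)$); it is consistent with a seed set if some infection chain with these seeds produces it. The temporal graph discovery (TGD) game with parameters $T_{\max},\delta,k,n$: the Discoverer first learns the node set $V$ ($|V|=n$) and the static edge set $E$; then in each round the Discoverer submits a set of at most $k$ seed infections and the Adversary answers with an infection log consistent with it on the Adversary's temporal graph; to end the game, the Discoverer submits a temporal graph, and the Adversary responds with a temporal graph (same static graph and lifetime) consistent with all infection logs given so far; the Adversary wins if the two differ, otherwise the Discoverer wins. "Winning the game on $\mathcal{G}$" means winning when the Adversary's logs are those of infection chains on $\mathcal{G}$.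 -}

module Defs where

open import Data.Nat using (ℕ; zero; suc; _+_; _*_; _≤_; _<_)
open import Data.Fin using (Fin)
open import Data.Bool using (Bool; true)
open import Data.Maybe using (Maybe; just)
open import Data.Product using (Σ; ∃; ∃-syntax; _×_; _,_)
open import Data.Sum using (_⊎_)
open import Data.Empty using (⊥)
open import Data.List using (List; []; _∷_; length)
open import Data.List.Membership.Propositional using (_∈_; _∉_)
open import Data.List.Relation.Unary.All using (All)
open import Relation.Binary.PropositionalEquality using (_≡_; _≢_)
open import Relation.Nullary using (¬_)

Edge : {n : ℕ} → (Fin n → Fin n → Bool) → Fin n → Fin n → Set
Edge adj u v = adj u v ≡ true

SimpleGraph : {n : ℕ} → (Fin n → Fin n → Bool) → Set
SimpleGraph {n} adj =
  (∀ (u v : Fin n) → adj u v ≡ adj v u) × (∀ (v : Fin n) → ¬ Edge adj v v)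

-- A labeling assigns a time to every ordered pair; only its values on
-- edges matter.
Labeling : ℕ → Set
Labeling n = Fin n → Fin n → ℕ

ValidLabeling : {n : ℕ} → ℕ → (Fin n → Fin n → Bool) → Labeling n → Set
ValidLabeling Tmax adj lab =
  ∀ u v → Edge adj u v → (1 ≤ lab u v) × (lab u v ≤ Tmax) × (lab u v ≡ lab v u)

SameTemporalGraph : {n : ℕ} → (Fin n → Fin n → Bool) → Labeling n → Labeling n → Set
SameTemporalGraph adj l₁ l₂ = ∀ u v → Edge adj u v → l₁ u v ≡ l₂ u v

Seeds : ℕ → Set
Seeds n = List (Fin n × ℕ)

-- An infection log: for each node v, either nothing (v never infected)
-- or just (u , t), meaning the triple (u , v , t) is in the log
-- (u ≡ v for a seed infection).  Each node is infected at most once,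
-- so this is exactly a set of triples with at most one triple per v.
Log : ℕ → Set
Log n = Fin n → Maybe (Fin n × ℕ)

InfectedBy : {n : ℕ} → Log n → Fin n → ℕ → Set
InfectedBy L v t = ∃[ u ] ∃[ t' ] (L v ≡ just (u , t')) × (t' ≤ t)

Infectious : {n : ℕ} → ℕ → Log n → Fin n → ℕ → Set
Infectious δ L u t = ∃[ w ] ∃[ s ] (L u ≡ just (w , s)) × (s < t) × (t ≤ s + δ)

IsInfectionLog : {n : ℕ} → (Fin n → Fin n → Bool) → ℕ → Labeling n →
                 Seeds n → Log n → Set
IsInfectionLog adj δ lab S L =
  (∀ v u t → L v ≡ just (u , t) →
      ( (u ≡ v) × ((v , t) ∈ S) × (∀ t' → t' < t → (v , t') ∉ S) )
    ⊎ ( Edge adj u v × (lab u v ≡ t) × Infectious δ L u t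
        × (∀ t' → t' ≤ t → (v , t') ∉ S) ))
  × (∀ v t → (v , t) ∈ S → InfectedBy L v t)
  × (∀ u v → Edge adj u v → Infectious δ L u (lab u v) → InfectedBy L v (lab u v))

History : ℕ → Set
History n = List (Seeds n × Log n)

data Move (n : ℕ) : Set where
  query : Seeds n → Move n
  guess : Labeling n → Move n

-- A Discoverer strategy (for a fixed, known V and E): maps the history of
-- queries and answers so far to the next move.
Strategy : ℕ → Set
Strategy n = History n → Move n

ValidSeeds : {n : ℕ} → ℕ → ℕ → Seeds n → Set
ValidSeeds Tmax k S = (length S ≤ k) × All (λ p → Data.Product.proj₂ p ≤ Tmax) S
  where import Data.Product

ConsistentWith : {n : ℕ} → (Fin n → Fin n → Bool) → ℕ → Labeling n → History n → Set
ConsistentWith adj δ H h = All (λ p → IsInfectionLog adj δ H (proj₁ p) (proj₂ p)) h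
  where open import Data.Product using (proj₁; proj₂)

Correct : {n : ℕ} → (Fin n → Fin n → Bool) → ℕ → ℕ → History n → Labeling n → Set
Correct adj Tmax δ h g =
  ∀ H → ValidLabeling Tmax adj H → ConsistentWith adj δ H h → SameTemporalGraph adj g H

-- σ wins, from history h, with at most N further query rounds, against
-- an Adversary whose answers are infection logs on the temporal graph
-- (adj , lab).
WinsWithin : {n : ℕ} → (Fin n → Fin n → Bool) → (Tmax δ k : ℕ) → Labeling n →
             Strategy n → ℕ → History n → Set
WinsWithin adj Tmax δ k lab σ N h = step N (σ h)
  where
  step : ℕ → Move _ → Set
  step N (guess g) = Correct adj Tmax δ h g
  step zero (query S) = ⊥
  step (suc N) (query S) =
    ValidSeeds Tmax k S ×
    (∀ L → IsInfectionLog adj δ lab S L → WinsWithin adj Tmax δ k lab σ N ((S , L) ∷ h))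

{-# OPTIONS --safe #-}
module Submission where

-- The Discoverer need not adapt: it seeds every pair (u , s) with s < Tmax on its own,
-- n · Tmax rounds in all. Under the single seed (u , s) nobody is infected before time s
-- and only u at time s, so a neighbour v with λ(uv) = s + 1 is infected at time s + 1,
-- necessarily by u. Conversely, in every temporal graph consistent with a log in which
-- u infects v at time t we have λ(uv) = t, since without loops this is no seed infection.
-- So reading off, for each edge uv, a time at which some log has u infect v recovers λ.

open import Defs
open import Data.Nat using (ℕ; zero; suc; _+_; _*_; _≤_; _<_; s≤s; s≤s⁻¹)
open import Data.Nat.Properties using (≤-refl; ≤-trans; ≤-antisym; <⇒≤; <⇒≱; m<m+n; m≤n⇒m<n∨m≡n)
open import Data.Nat.Induction using (<-rec)
open import Data.Fin using (Fin; _≟_)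
open import Data.Bool using (Bool)
open import Data.Maybe using (Maybe; just; nothing; fromMaybe)
open import Data.Product using (Σ; ∃-syntax; _×_; _,_; proj₁; proj₂)
open import Data.Sum using (_⊎_; inj₁; inj₂)
open import Data.List using (List; []; _∷_; [_]; _++_; length; drop; map; cartesianProduct; allFin; upTo)
open import Data.List.Properties using (length-++; length-map; length-tabulate; length-upTo)
open import Data.List.Membership.Propositional using (_∈_)
open import Data.List.Membership.Propositional.Properties
  using (∈-map⁺; ∈-map⁻; ∈-cartesianProduct⁺; ∈-cartesianProduct⁻; ∈-allFin; ∈-upTo⁺; ∈-upTo⁻)
open import Data.List.Relation.Unary.All as All using (All; []; _∷_)
open import Data.List.Relation.Unary.Any using (here; there)
open import Relation.Binary.PropositionalEquality using (_≡_; refl; sym; cong₂; subst; module ≡-Reasoning)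
open import Function using (id; case_of_)
open import Relation.Nullary using (¬_; yes; no; contradiction)

drop-suc : ∀ {A : Set} m (xs : List A) {x ys} → drop m xs ≡ x ∷ ys → drop (suc m) xs ≡ ys
drop-suc zero    (_ ∷ _)  refl = refl
drop-suc (suc m) (_ ∷ xs) eq   = drop-suc m xs eq

length-cartesianProduct : ∀ {A B : Set} (xs : List A) (ys : List B) →
                          length (cartesianProduct xs ys) ≡ length xs * length ys
length-cartesianProduct []       ys = refl
length-cartesianProduct (x ∷ xs) ys = begin
  length (map (x ,_) ys ++ cartesianProduct xs ys)
    ≡⟨ length-++ (map (x ,_) ys) ⟩
  length (map (x ,_) ys) + length (cartesianProduct xs ys)
    ≡⟨ cong₂ _+_ (length-map (x ,_) ys) (length-cartesianProduct xs ys) ⟩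
  length ys + length xs * length ys ∎
  where open ≡-Reasoning

Loopless : ∀ {n} → (Fin n → Fin n → Bool) → Set
Loopless adj = ∀ x → ¬ Edge adj x x

module _ {n : ℕ} {adj : Fin n → Fin n → Bool} {δ : ℕ} {lab : Labeling n} where

  seed-precedes-infection : ∀ {S L x w t} → IsInfectionLog adj δ lab S L → L x ≡ just (w , t) →
                  ∃[ y ] ∃[ s ] (y , s) ∈ S × s ≤ t
  seed-precedes-infection {S} {L} isL = <-rec P go _
    where
    P : ℕ → Set
    P t = ∀ {x w} → L x ≡ just (w , t) → ∃[ y ] ∃[ s ] (y , s) ∈ S × s ≤ t
    go : ∀ t → (∀ {t'} → t' < t → P t') → P t
    go t rec Lx with proj₁ isL _ _ t Lx
    ... | inj₁ (_ , seed , _) = _ , t , seed , ≤-refl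
    ... | inj₂ (_ , _ , (_ , t' , Lw , t'<t , _) , _) with y , s , seed , s≤t' ← rec t'<t Lw =
          y , s , seed , ≤-trans s≤t' (<⇒≤ t'<t)

  label-of-infection : ∀ {S L u v t} → Loopless adj → IsInfectionLog adj δ lab S L →
                       Edge adj u v → L v ≡ just (u , t) → lab u v ≡ t
  label-of-infection loopless isL e Lv with proj₁ isL _ _ _ Lv
  ... | inj₁ (refl , _)      = contradiction e (loopless _)
  ... | inj₂ (_ , lab≡ , _) = lab≡

  module SingleSeed {u : Fin n} {s : ℕ} {L : Log n}
                    (isL : IsInfectionLog adj δ lab [ (u , s) ] L) where

    not-before-seed : ∀ {x w t} → L x ≡ just (w , t) → s ≤ t
    not-before-seed Lx with _ , _ , here refl , s≤t ← seed-precedes-infection isL Lx = s≤t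

    only-seed-at-seed-time : ∀ {x w} → L x ≡ just (w , s) → x ≡ u
    only-seed-at-seed-time Lx with proj₁ isL _ _ _ Lx
    ... | inj₁ (_ , here refl , _) = refl
    ... | inj₂ (_ , _ , (_ , _ , Lw , t'<s , _) , _) = contradiction (not-before-seed Lw) (<⇒≱ t'<s)

    seed-infected-at-seed-time : ∃[ w ] L u ≡ just (w , s)
    seed-infected-at-seed-time with w , t , Lu , t≤s ← proj₁ (proj₂ isL) u s (here refl)
      with refl ← ≤-antisym t≤s (not-before-seed Lu) = w , Lu

    next-infected-by-seed : ∀ {x w} → L x ≡ just (w , suc s) → w ≡ u
    next-infected-by-seed Lx with proj₁ isL _ _ _ Lx
    ... | inj₁ (_ , here () , _)
    ... | inj₂ (_ , _ , (_ , _ , Lw , t'<1+s , _) , _)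
      with refl ← ≤-antisym (s≤s⁻¹ t'<1+s) (not-before-seed Lw) = only-seed-at-seed-time Lw

    seed-infectious : 1 ≤ δ → Infectious δ L u (suc s)
    seed-infectious δ≥1 with w , Lu ← seed-infected-at-seed-time = w , s , Lu , ≤-refl , m<m+n s δ≥1

    probe : ∀ {v} → Loopless adj → 1 ≤ δ → Edge adj u v → lab u v ≡ suc s →
            L v ≡ just (u , suc s)
    probe {v} loopless δ≥1 e lab≡
      with x , t , Lv , t≤1+s ← subst (InfectedBy L v) lab≡
             (proj₂ (proj₂ isL) u v e (subst (Infectious δ L u) (sym lab≡) (seed-infectious δ≥1)))
      with m≤n⇒m<n∨m≡n t≤1+s
    ... | inj₁ t<1+s with refl ← ≤-antisym (s≤s⁻¹ t<1+s) (not-before-seed Lv) =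
          contradiction (subst (Edge adj u) (only-seed-at-seed-time Lv) e) (loopless u)
    ... | inj₂ refl with refl ← next-infected-by-seed Lv = Lv

nextMove : ∀ {n} → List (Seeds n) → Labeling n → Move n
nextMove []      g = guess g
nextMove (S ∷ _) _ = query S

nonAdaptive : ∀ {n} → List (Seeds n) → (History n → Labeling n) → Strategy n
nonAdaptive qs decide h = nextMove (drop (length h) qs) (decide h)

Logged : ∀ {n} → (Fin n → Fin n → Bool) → ℕ → Labeling n → Seeds n → History n → Set
Logged adj δ lab S h = ∃[ L ] (S , L) ∈ h × IsInfectionLog adj δ lab S L

module _ {n Tmax δ k : ℕ} {adj : Fin n → Fin n → Bool} {lab : Labeling n}
         (qs : List (Seeds n)) (decide : History n → Labeling n) where

  nonAdaptive-wins : All (ValidSeeds Tmax k) qs →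
                     (∀ h → (∀ {S} → S ∈ qs → Logged adj δ lab S h) → Correct adj Tmax δ h (decide h)) →
                     WinsWithin adj Tmax δ k lab (nonAdaptive qs decide) (length qs) []
  nonAdaptive-wins valid correct = wins-from qs [] refl valid inj₁
    where
    wins-from : ∀ rest h → drop (length h) qs ≡ rest → All (ValidSeeds Tmax k) rest →
                (∀ {S} → S ∈ qs → S ∈ rest ⊎ Logged adj δ lab S h) →
                WinsWithin adj Tmax δ k lab (nonAdaptive qs decide) (length rest) h
    wins-from [] h drop≡ _ pending rewrite drop≡ =
      correct h λ S∈qs → case pending S∈qs of λ where
        (inj₁ ())
        (inj₂ logged) → logged
    wins-from (S ∷ rest) h drop≡ (validS ∷ valid) pending rewrite drop≡ =
      validS , λ L isL →
        wins-from rest ((S , L) ∷ h) (drop-suc (length h) qs drop≡) valid (answered L isL)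
      where
      answered : ∀ L → IsInfectionLog adj δ lab S L → ∀ {S'} → S' ∈ qs →
                 S' ∈ rest ⊎ Logged adj δ lab S' ((S , L) ∷ h)
      answered L isL S'∈qs with pending S'∈qs
      ... | inj₁ (here refl)           = inj₂ (L , here refl , isL)
      ... | inj₁ (there S'∈rest)       = inj₁ S'∈rest
      ... | inj₂ (L' , S'L'∈h , isL') = inj₂ (L' , there S'L'∈h , isL')

timeInfectedBy : ∀ {n} → Fin n → Maybe (Fin n × ℕ) → Maybe ℕ
timeInfectedBy u nothing = nothing
timeInfectedBy u (just (w , t)) with w ≟ u
... | yes _ = just t
... | no _  = nothing

timeInfectedBy-self : ∀ {n} (u : Fin n) t → timeInfectedBy u (just (u , t)) ≡ just t
timeInfectedBy-self u t with u ≟ u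
... | yes _  = refl
... | no u≢u = contradiction refl u≢u

timeInfectedBy-just : ∀ {n} {u : Fin n} {m t} → timeInfectedBy u m ≡ just t → m ≡ just (u , t)
timeInfectedBy-just {u = u} {just (w , _)} eq with w ≟ u | eq
... | yes refl | refl = refl
... | no _     | ()

decode : ∀ {n} → History n → Labeling n
decode []            u v = 0
decode ((_ , L) ∷ h) u v = fromMaybe (decode h u v) (timeInfectedBy u (L v))

decode-correct : ∀ {n adj δ H h S L u v t} → Loopless adj →
                 ConsistentWith {n} adj δ H h → Edge adj u v →
                 (S , L) ∈ h → L v ≡ just (u , t) → decode h u v ≡ H u v
decode-correct {u = u} {v} {t} loopless (isL ∷ _) e (here refl) Lv
  rewrite Lv | timeInfectedBy-self u t = sym (label-of-infection loopless isL e Lv)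
decode-correct {h = (_ , L') ∷ _} {u = u} {v} loopless (isL' ∷ consistent) e (there SL∈h) Lv
  with timeInfectedBy u (L' v) in found
... | just t' = sym (label-of-infection loopless isL' e (timeInfectedBy-just found))
... | nothing = decode-correct loopless consistent e SL∈h Lv

probes : (n Tmax : ℕ) → List (Seeds n)
probes n Tmax = map [_] (cartesianProduct (allFin n) (upTo Tmax))

length-probes : ∀ n Tmax → length (probes n Tmax) ≡ n * Tmax
length-probes n Tmax = begin
  length (map [_] (cartesianProduct (allFin n) (upTo Tmax)))
    ≡⟨ length-map [_] (cartesianProduct (allFin n) (upTo Tmax)) ⟩
  length (cartesianProduct (allFin n) (upTo Tmax))
    ≡⟨ length-cartesianProduct (allFin n) (upTo Tmax) ⟩
  length (allFin n) * length (upTo Tmax)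
    ≡⟨ cong₂ _*_ (length-tabulate {n = n} id) (length-upTo Tmax) ⟩
  n * Tmax ∎
  where open ≡-Reasoning

probe-∈-probes : ∀ {n Tmax} (u : Fin n) {s} → s < Tmax → [ (u , s) ] ∈ probes n Tmax
probe-∈-probes u s<Tmax = ∈-map⁺ [_] (∈-cartesianProduct⁺ (∈-allFin u) (∈-upTo⁺ s<Tmax))

probes-valid : ∀ {n Tmax k} → 1 ≤ k → All (ValidSeeds Tmax k) (probes n Tmax)
probes-valid {n} {Tmax} k≥1 = All.tabulate λ S∈probes →
  case ∈-map⁻ [_] S∈probes of λ where
    ((_ , s) , us∈ , refl) →
      let _ , s∈upTo = ∈-cartesianProduct⁻ (allFin n) (upTo Tmax) us∈
      in k≥1 , <⇒≤ (∈-upTo⁻ s∈upTo) ∷ []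

positive-bounded : ∀ {m Tmax} → 1 ≤ m → m ≤ Tmax → ∃[ s ] m ≡ suc s × s < Tmax
positive-bounded {suc s} (s≤s _) m≤Tmax = s , refl , m≤Tmax

decode-probes-correct : ∀ {n Tmax δ} {adj : Fin n → Fin n → Bool} {lab : Labeling n} →
                        Loopless adj → 1 ≤ δ → ValidLabeling Tmax adj lab →
                        ∀ h → (∀ {S} → S ∈ probes n Tmax → Logged adj δ lab S h) →
                        Correct adj Tmax δ h (decode h)
decode-probes-correct loopless δ≥1 valid h logged H _ consistent u v e
  with 1≤lab , lab≤Tmax , _ ← valid u v e
  with s , lab≡ , s<Tmax ← positive-bounded 1≤lab lab≤Tmax
  with L , SL∈h , isL ← logged (probe-∈-probes u s<Tmax) =
  decode-correct loopless consistent e SL∈h (SingleSeed.probe isL loopless δ≥1 e lab≡)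

theorem1 : (n Tmax δ k : ℕ) (adj : Fin n → Fin n → Bool) →
           SimpleGraph adj → 1 ≤ δ → 1 ≤ k →
           Σ (Strategy n) (λ σ → (lab : Labeling n) → ValidLabeling Tmax adj lab →
             WinsWithin adj Tmax δ k lab σ (n * Tmax) [])
theorem1 n Tmax δ k adj (_ , loopless) δ≥1 k≥1 = σ , wins
  where
  σ : Strategy n
  σ = nonAdaptive (probes n Tmax) decode

  wins : (lab : Labeling n) → ValidLabeling Tmax adj lab → WinsWithin adj Tmax δ k lab σ (n * Tmax) []
  wins lab valid = subst (λ N → WinsWithin adj Tmax δ k lab σ N []) (length-probes n Tmax)
    (nonAdaptive-wins (probes n Tmax) decode (probes-valid k≥1) (decode-probes-correct loopless δ≥1 valid))
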